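{- Let $D$ be a digraph of order $n$ with minimum in-degree $\delta^-\ge1$. Then $L_2(D)\le \frac{2n}{\delta^-+1}$, with equality if and only if $D\in\Omega$.
   Context: Digraphs are finite, without loops or multiple arcs (opposite arcs allowed). $N^+[v]=N^+(v)\cup\{v\}$. A $2$-limited packing is a set $B\subseteq V(D)$ with $|N^+[v]\cap B|\le2$ for every vertex $v$; $L_2(D)$ is its maximum size. A digraph is functional if every vertex has out-degree exactly one. The family $\Omega$: start with a functional digraph $D'$ with $V(D')=\{v_1,\dots,v_{n'}\}$. Choose an integer $r\ge\Delta^-(D')$ (maximum in-degree of $D'$) such that $p=(r-1)n'$ is even. Add a set of new vertices $U=\{u_1,\dots,u_{p/2}\}$ and new arcs of the form $(u_i,v_j)$ such that (i) every $u_i$ is incident with precisely two such arcs, and (ii) $\deg^-(v_j)=r$ for all $1\le j\le n'$. Then add some arcs among the vertices of $U$ and some arcs from $V(D')$ to $U$, such that $r$ is the minimum in-degree of the resulting digraph. $\Omega$ is the family of all digraphs obtained this way. -}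

module Defs where

open import Data.Nat using (ℕ; zero; suc; _+_; _*_; _∸_; _≤_)
open import Data.Bool using (Bool; true; false; if_then_else_; _∧_; _∨_; not)
open import Data.Fin using (Fin; zero; suc; _≟_)
open import Data.Product using (Σ; _×_; ∃; ∃-syntax)
open import Relation.Nullary.Decidable using (⌊_⌋)
open import Relation.Binary.PropositionalEquality using (_≡_)

countB : ∀ {n} → (Fin n → Bool) → ℕ
countB {zero}  f = 0
countB {suc n} f = (if f zero then 1 else 0) + countB (λ i → f (suc i))

-- A finite digraph on vertex set Fin n: adj u v ≡ true iff (u , v) is an arc.
-- No loops; no multiple arcs (a Boolean relation); opposite arcs allowed.
record Digraph (n : ℕ) : Set where
  field
    adj      : Fin n → Fin n → Bool
    loopless : ∀ v → adj v v ≡ false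
open Digraph public

VSet : ℕ → Set
VSet n = Fin n → Bool

inDeg : ∀ {n} → Digraph n → Fin n → ℕ
inDeg D v = countB (λ u → adj D u v)

inClosedOut : ∀ {n} → Digraph n → Fin n → Fin n → Bool
inClosedOut D v w = ⌊ w ≟ v ⌋ ∨ adj D v w

Is2LimitedPacking : ∀ {n} → Digraph n → VSet n → Set
Is2LimitedPacking D B = ∀ v → countB (λ w → B w ∧ inClosedOut D v w) ≤ 2

IsL2 : ∀ {n} → Digraph n → ℕ → Set
IsL2 D k =
  (Σ (VSet _) λ B → Is2LimitedPacking D B × countB B ≡ k)
  × (∀ B → Is2LimitedPacking D B → countB B ≤ k)

IsMinInDeg : ∀ {n} → Digraph n → ℕ → Set
IsMinInDeg D δ = (∀ v → δ ≤ inDeg D v) × (∃[ v ] inDeg D v ≡ δ)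

-- Membership in the family Ω (up to isomorphism, i.e. up to naming the vertices):
-- S is the vertex set V(D') (S v ≡ true), its complement is U.
-- D' = D[S] (the only arcs inside V(D') are those of D'), all other arcs of D go
-- U→V(D'), inside U, or V(D')→U.
InΩ : ∀ {n} → Digraph n → Set
InΩ {n} D = Σ (VSet n) λ S → Σ ℕ λ r →
    (∀ v → S v ≡ true → countB (λ w → S w ∧ adj D v w) ≡ 1)
  × (∀ v → S v ≡ true → countB (λ u → S u ∧ adj D u v) ≤ r)
    -- |U| = p/2 with p = (r-1)n' (so p is even)
  × (countB (λ u → not (S u)) * 2 ≡ (r ∸ 1) * countB S)
  × (∀ u → S u ≡ false → countB (λ v → S v ∧ adj D u v) ≡ 2)
  × (∀ v → S v ≡ true → inDeg D v ≡ r)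
  × IsMinInDeg D r

-- Count the pairs (v, w) with w ∈ B ∩ N⁺[v] in two ways: every v contributes at most 2,
-- and every w ∈ B contributes |N⁻[w]| = 1 + deg⁻(w) ≥ 1 + δ⁻, so |B|(δ⁻ + 1) ≤ 2n.
-- Equality forces |N⁺[v] ∩ B| = 2 for every v and deg⁻(w) = δ⁻ on B: taking V(D') = B,
-- r = δ⁻ and U the complement of B, each vertex of B has one out-neighbour in B, each vertex
-- of U two, and 2|U| = (δ⁻ − 1)|B| is |B|(δ⁻ + 1) = 2n rearranged. Conversely, V(D') is a
-- 2-limited packing of any D ∈ Ω, of size 2n/(r + 1), and r = δ⁻.
module Submission where

open import Defs
open import Data.Nat using (ℕ; zero; suc; _+_; _*_; _∸_; _≤_; z≤n; s≤s)
open import Data.Nat.Properties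
  using (≤-refl; ≤-trans; ≤-antisym; ≤-reflexive; +-mono-≤; +-monoʳ-≤; +-monoˡ-≤; +-suc;
         +-cancelˡ-≤; +-cancelʳ-≤; +-cancelˡ-≡; *-monoˡ-≤; suc-injective; *-comm; module ≤-Reasoning;
         +-commutativeSemigroup; +-0-commutativeMonoid)
open import Data.Nat.Solver using (module +-*-Solver)
open import Data.Bool using (Bool; true; false; if_then_else_; _∧_; _∨_; not)
open import Data.Fin using (Fin; zero; suc; _≟_)
open import Data.Product using (_×_; _,_; Σ-syntax)
open import Function.Bundles using (_⇔_; mk⇔; module Equivalence)
open import Relation.Nullary using (does)
open import Relation.Nullary.Decidable using (⌊_⌋; ⌊⌋-map′; isYes≗does; does-⇔)
open import Relation.Binary.PropositionalEquality
open import Algebra.Properties.CommutativeSemigroup +-commutativeSemigroup using (x∙yz≈y∙xz)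
open import Algebra.Properties.CommutativeMonoid.Sum +-0-commutativeMonoid
  using (sum; ∑-comm; sum-cong-≗; sum-replicate-zero)

private
  variable
    n : ℕ

sum-mono-≤ : (f g : Fin n → ℕ) → (∀ i → f i ≤ g i) → sum f ≤ sum g
sum-mono-≤ {zero}  f g f≤g = z≤n
sum-mono-≤ {suc n} f g f≤g = +-mono-≤ (f≤g zero) (sum-mono-≤ _ _ (λ i → f≤g (suc i)))

sum-const : ∀ n m → sum {n} (λ _ → m) ≡ n * m
sum-const zero    m = refl
sum-const (suc n) m = cong (m +_) (sum-const n m)

sum-tight : (f g : Fin n → ℕ) → (∀ i → f i ≤ g i) → sum g ≤ sum f → ∀ i → f i ≡ g i
sum-tight f g f≤g Σg≤Σf zero = ≤-antisym (f≤g zero)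
  (+-cancelʳ-≤ _ (g zero) (f zero) (≤-trans Σg≤Σf (+-monoʳ-≤ (f zero) (sum-mono-≤ _ _ (λ i → f≤g (suc i))))))
sum-tight f g f≤g Σg≤Σf (suc i) = sum-tight _ _ (λ j → f≤g (suc j))
  (+-cancelˡ-≤ (g zero) _ _ (≤-trans Σg≤Σf (+-monoˡ-≤ _ (f≤g zero)))) i

ind : Bool → ℕ
ind b = if b then 1 else 0

countB≡sum : (f : VSet n) → countB f ≡ sum (λ i → ind (f i))
countB≡sum {zero}  f = refl
countB≡sum {suc n} f = cong (ind (f zero) +_) (countB≡sum (λ i → f (suc i)))

countB-cong : (f g : VSet n) → (∀ i → f i ≡ g i) → countB f ≡ countB g
countB-cong f g f≗g = begin
  countB f                 ≡⟨ countB≡sum f ⟩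
  sum (λ i → ind (f i))    ≡⟨ sum-cong-≗ (λ i → cong ind (f≗g i)) ⟩
  sum (λ i → ind (g i))    ≡⟨ countB≡sum g ⟨
  countB g                 ∎
  where open ≡-Reasoning

countB-∧-≤ : (g f : VSet n) → countB (λ i → g i ∧ f i) ≤ countB f
countB-∧-≤ {zero}  g f = z≤n
countB-∧-≤ {suc n} g f = +-mono-≤ (ind-∧ (g zero) (f zero)) (countB-∧-≤ (λ i → g (suc i)) (λ i → f (suc i)))
  where
  ind-∧ : ∀ a b → ind (a ∧ b) ≤ ind b
  ind-∧ true  b = ≤-refl
  ind-∧ false b = z≤n

countB-+-complement : (S : VSet n) → countB S + countB (λ i → not (S i)) ≡ n
countB-+-complement {zero}  S = refl
countB-+-complement {suc n} S with S zero
... | true  = cong suc (countB-+-complement (λ i → S (suc i)))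
... | false = trans (+-suc _ _) (cong suc (countB-+-complement (λ i → S (suc i))))

countB-∧-insert : (B g : VSet n) (w : Fin n) → g w ≡ false →
  countB (λ x → B x ∧ (⌊ x ≟ w ⌋ ∨ g x)) ≡ ind (B w) + countB (λ x → B x ∧ g x)
countB-∧-insert {suc n} B g zero gw≡false with B zero
... | true  rewrite gw≡false = refl
... | false = refl
countB-∧-insert {suc n} B g (suc w) gw≡false = begin
  b₀ + countB (λ x → B (suc x) ∧ (⌊ suc x ≟ suc w ⌋ ∨ g (suc x)))
    ≡⟨ cong (b₀ +_) (countB-cong _ _ (λ x → cong (λ b → B (suc x) ∧ (b ∨ g (suc x))) (⌊⌋-map′ _ _ (x ≟ w)))) ⟩
  b₀ + countB (λ x → B (suc x) ∧ (⌊ x ≟ w ⌋ ∨ g (suc x)))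
    ≡⟨ cong (b₀ +_) (countB-∧-insert (λ x → B (suc x)) (λ x → g (suc x)) w gw≡false) ⟩
  b₀ + (ind (B (suc w)) + countB (λ x → B (suc x) ∧ g (suc x)))
    ≡⟨ x∙yz≈y∙xz b₀ (ind (B (suc w))) _ ⟩
  ind (B (suc w)) + (b₀ + countB (λ x → B (suc x) ∧ g (suc x)))
    ∎
  where
  open ≡-Reasoning
  b₀ = ind (B zero ∧ g zero)

sumOn : VSet n → (Fin n → ℕ) → ℕ
sumOn B f = sum (λ w → if B w then f w else 0)

sumOn-const : (B : VSet n) (m : ℕ) → sumOn B (λ _ → m) ≡ countB B * m
sumOn-const {zero}  B m = refl
sumOn-const {suc n} B m with B zero
... | true  = cong (m +_) (sumOn-const (λ i → B (suc i)) m)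
... | false = sumOn-const (λ i → B (suc i)) m

private
  if-mono-≤ : ∀ b {x y} → x ≤ y → (if b then x else 0) ≤ (if b then y else 0)
  if-mono-≤ true  x≤y = x≤y
  if-mono-≤ false x≤y = z≤n

sumOn-mono-≤ : (B : VSet n) (f g : Fin n → ℕ) → (∀ w → f w ≤ g w) → sumOn B f ≤ sumOn B g
sumOn-mono-≤ B f g f≤g = sum-mono-≤ _ _ (λ w → if-mono-≤ (B w) (f≤g w))

sumOn-tight : (B : VSet n) (f g : Fin n → ℕ) → (∀ w → f w ≤ g w) → sumOn B g ≤ sumOn B f →
  ∀ w → B w ≡ true → f w ≡ g w
sumOn-tight B f g f≤g Σg≤Σf w Bw≡true =
  subst (λ b → (if b then f w else 0) ≡ (if b then g w else 0)) Bw≡true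
    (sum-tight _ _ (λ v → if-mono-≤ (B v) (f≤g v)) Σg≤Σf w)

⌊≟⌋-sym : (x y : Fin n) → ⌊ x ≟ y ⌋ ≡ ⌊ y ≟ x ⌋
⌊≟⌋-sym x y = begin
  ⌊ x ≟ y ⌋        ≡⟨ isYes≗does (x ≟ y) ⟩
  does (x ≟ y)     ≡⟨ does-⇔ (mk⇔ sym sym) (x ≟ y) (y ≟ x) ⟩
  does (y ≟ x)     ≡⟨ isYes≗does (y ≟ x) ⟨
  ⌊ y ≟ x ⌋        ∎
  where open ≡-Reasoning

s*[2+d]≡2*[s+m]⇔m*2≡d*s : ∀ s m d → (s * suc (suc d) ≡ 2 * (s + m)) ⇔ (m * 2 ≡ d * s)
s*[2+d]≡2*[s+m]⇔m*2≡d*s s m d = mk⇔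
  (λ eq → sym (+-cancelˡ-≡ (s + s) _ _ (trans (sym (lhs s d)) (trans eq (rhs s m)))))
  (λ eq → trans (lhs s d) (trans (cong (s + s +_) (sym eq)) (sym (rhs s m))))
  where
  open +-*-Solver
  lhs : ∀ s d → s * suc (suc d) ≡ s + s + d * s
  lhs = solve 2 (λ s d → s :* (con 2 :+ d) := s :+ s :+ d :* s) refl
  rhs : ∀ s m → 2 * (s + m) ≡ s + s + m * 2
  rhs = solve 2 (λ s m → con 2 :* (s :+ m) := s :+ s :+ m :* con 2) refl

module _ (D : Digraph n) where

  ∣N⁺[_]∩_∣ : Fin n → VSet n → ℕ
  ∣N⁺[ v ]∩ B ∣ = countB (λ w → B w ∧ inClosedOut D v w)

  ∣N⁺[]∩∣-split : ∀ v B → ∣N⁺[ v ]∩ B ∣ ≡ ind (B v) + countB (λ w → B w ∧ adj D v w)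
  ∣N⁺[]∩∣-split v B = countB-∧-insert B (adj D v) v (loopless D v)

  ∣N⁻[]∣≡1+inDeg : ∀ w → countB (λ v → inClosedOut D v w) ≡ suc (inDeg D w)
  ∣N⁻[]∣≡1+inDeg w = trans
    (countB-cong _ _ (λ v → cong (_∨ adj D v w) (⌊≟⌋-sym w v)))
    (countB-∧-insert (λ _ → true) (λ v → adj D v w) w (loopless D w))

  double-counting : ∀ B → sum (λ v → ∣N⁺[ v ]∩ B ∣) ≡ sumOn B (λ w → suc (inDeg D w))
  double-counting B = begin
    sum (λ v → ∣N⁺[ v ]∩ B ∣)
      ≡⟨ sum-cong-≗ (λ v → countB≡sum (λ w → B w ∧ inClosedOut D v w)) ⟩
    sum (λ v → sum (λ w → ind (B w ∧ inClosedOut D v w)))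
      ≡⟨ ∑-comm (λ v w → ind (B w ∧ inClosedOut D v w)) ⟩
    sum (λ w → sum (λ v → ind (B w ∧ inClosedOut D v w)))
      ≡⟨ sum-cong-≗ column ⟩
    sumOn B (λ w → suc (inDeg D w))
      ∎
    where
    open ≡-Reasoning
    column : ∀ w → sum (λ v → ind (B w ∧ inClosedOut D v w)) ≡ (if B w then suc (inDeg D w) else 0)
    column w with B w
    ... | true  = trans (sym (countB≡sum (λ v → inClosedOut D v w))) (∣N⁻[]∣≡1+inDeg w)
    ... | false = sum-replicate-zero n

  private
    ∑∣N⁺[]∩∣≤2*n : ∀ B → Is2LimitedPacking D B → sum (λ v → ∣N⁺[ v ]∩ B ∣) ≤ 2 * n
    ∑∣N⁺[]∩∣≤2*n B B-packing = ≤-trans (sum-mono-≤ _ _ B-packing) (≤-reflexive ∑2≡2*n)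
      where
      ∑2≡2*n : sum {n} (λ _ → 2) ≡ 2 * n
      ∑2≡2*n = trans (sum-const n 2) (*-comm n 2)

    ∣B∣*[1+δ]≤∑∣N⁺[]∩∣ : ∀ δ B → (∀ v → δ ≤ inDeg D v) → countB B * suc δ ≤ sum (λ v → ∣N⁺[ v ]∩ B ∣)
    ∣B∣*[1+δ]≤∑∣N⁺[]∩∣ δ B δ≤inDeg = begin
      countB B * suc δ                   ≡⟨ sumOn-const B (suc δ) ⟨
      sumOn B (λ _ → suc δ)              ≤⟨ sumOn-mono-≤ B _ _ (λ w → s≤s (δ≤inDeg w)) ⟩
      sumOn B (λ w → suc (inDeg D w))    ≡⟨ double-counting B ⟨
      sum (λ v → ∣N⁺[ v ]∩ B ∣)          ∎
      where open ≤-Reasoning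

  packing-bound : ∀ δ B → (∀ v → δ ≤ inDeg D v) → Is2LimitedPacking D B → countB B * suc δ ≤ 2 * n
  packing-bound δ B δ≤inDeg B-packing = ≤-trans (∣B∣*[1+δ]≤∑∣N⁺[]∩∣ δ B δ≤inDeg) (∑∣N⁺[]∩∣≤2*n B B-packing)

  module _ (δ : ℕ) (B : VSet n) (δ≤inDeg : ∀ v → δ ≤ inDeg D v) (B-packing : Is2LimitedPacking D B)
           (tight : countB B * suc δ ≡ 2 * n) where
    open ≤-Reasoning

    tight-packing⇒∣N⁺[]∩∣≡2 : ∀ v → ∣N⁺[ v ]∩ B ∣ ≡ 2
    tight-packing⇒∣N⁺[]∩∣≡2 = sum-tight _ _ B-packing (begin
      sum {n} (λ _ → 2)                  ≡⟨ sum-const n 2 ⟩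
      n * 2                              ≡⟨ *-comm n 2 ⟩
      2 * n                              ≡⟨ tight ⟨
      countB B * suc δ                   ≤⟨ ∣B∣*[1+δ]≤∑∣N⁺[]∩∣ δ B δ≤inDeg ⟩
      sum (λ v → ∣N⁺[ v ]∩ B ∣)          ∎)

    tight-packing⇒inDeg≡δ : ∀ w → B w ≡ true → inDeg D w ≡ δ
    tight-packing⇒inDeg≡δ w Bw≡true = suc-injective (sym (sumOn-tight B _ _ (λ w → s≤s (δ≤inDeg w)) (begin
      sumOn B (λ w → suc (inDeg D w))    ≡⟨ double-counting B ⟨
      sum (λ v → ∣N⁺[ v ]∩ B ∣)          ≤⟨ ∑∣N⁺[]∩∣≤2*n B B-packing ⟩
      2 * n                              ≡⟨ tight ⟨
      countB B * suc δ                   ≡⟨ sumOn-const B (suc δ) ⟨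
      sumOn B (λ _ → suc δ)              ∎) w Bw≡true))

  IsMinInDeg-unique : ∀ {δ δ′} → IsMinInDeg D δ → IsMinInDeg D δ′ → δ ≡ δ′
  IsMinInDeg-unique (δ≤inDeg , v , inDeg≡δ) (δ′≤inDeg , v′ , inDeg≡δ′) =
    ≤-antisym (≤-trans (δ≤inDeg v′) (≤-reflexive inDeg≡δ′)) (≤-trans (δ′≤inDeg v) (≤-reflexive inDeg≡δ))

  tight-packing⇒InΩ : ∀ d B → IsMinInDeg D (suc d) → Is2LimitedPacking D B →
    countB B * suc (suc d) ≡ 2 * n → InΩ D
  tight-packing⇒InΩ d B minInDeg@(δ≤inDeg , _) B-packing tight =
    B , suc d , functional , Δ⁻≤δ , balance , two-arcs , inDeg≡δ , minInDeg
    where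
    inDeg≡δ = tight-packing⇒inDeg≡δ (suc d) B δ≤inDeg B-packing tight
    ∣N⁺∩B∣ : Fin n → ℕ
    ∣N⁺∩B∣ v = countB (λ w → B w ∧ adj D v w)
    out-count : ∀ v → ind (B v) + ∣N⁺∩B∣ v ≡ 2
    out-count v = trans (sym (∣N⁺[]∩∣-split v B)) (tight-packing⇒∣N⁺[]∩∣≡2 (suc d) B δ≤inDeg B-packing tight v)
    functional : ∀ v → B v ≡ true → ∣N⁺∩B∣ v ≡ 1
    functional v Bv≡true = suc-injective (subst (λ b → ind b + ∣N⁺∩B∣ v ≡ 2) Bv≡true (out-count v))
    two-arcs : ∀ u → B u ≡ false → ∣N⁺∩B∣ u ≡ 2
    two-arcs u Bu≡false = subst (λ b → ind b + ∣N⁺∩B∣ u ≡ 2) Bu≡false (out-count u)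
    Δ⁻≤δ : ∀ v → B v ≡ true → countB (λ u → B u ∧ adj D u v) ≤ suc d
    Δ⁻≤δ v Bv≡true = ≤-trans (countB-∧-≤ B (λ u → adj D u v)) (≤-reflexive (inDeg≡δ v Bv≡true))
    balance : countB (λ u → not (B u)) * 2 ≡ d * countB B
    balance = Equivalence.to (s*[2+d]≡2*[s+m]⇔m*2≡d*s (countB B) _ d)
      (trans tight (cong (2 *_) (sym (countB-+-complement B))))

  InΩ⇒tight-packing : ∀ d → IsMinInDeg D (suc d) → InΩ D →
    Σ[ S ∈ VSet n ] Is2LimitedPacking D S × countB S * suc (suc d) ≡ 2 * n
  InΩ⇒tight-packing d minInDeg (S , _ , functional , _ , balance , two-arcs , _ , minInDeg′) =
    S , (λ v → ≤-reflexive (trans (∣N⁺[]∩∣-split v S) (out-count v))) , tight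
    where
    out-count : ∀ v → ind (S v) + countB (λ w → S w ∧ adj D v w) ≡ 2
    out-count v with S v in Sv
    ... | true  = cong suc (functional v Sv)
    ... | false = two-arcs v Sv
    balance′ : countB (λ u → not (S u)) * 2 ≡ d * countB S
    balance′ = subst (λ r → _ ≡ (r ∸ 1) * countB S) (sym (IsMinInDeg-unique minInDeg minInDeg′)) balance
    tight : countB S * suc (suc d) ≡ 2 * n
    tight = trans (Equivalence.from (s*[2+d]≡2*[s+m]⇔m*2≡d*s (countB S) _ d) balance′)
                  (cong (2 *_) (countB-+-complement S))

theorem2 : ∀ {n} (D : Digraph n) (δ k : ℕ) → IsMinInDeg D δ → 1 ≤ δ → IsL2 D k →
    (k * suc δ ≤ 2 * n) × ((k * suc δ ≡ 2 * n) ⇔ InΩ D)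
theorem2 {n} D (suc d) _ minInDeg@(δ≤inDeg , _) (s≤s z≤n) ((B , B-packing , refl) , maximum) =
  packing-bound D (suc d) B δ≤inDeg B-packing ,
  mk⇔ (tight-packing⇒InΩ D d B minInDeg B-packing) InΩ⇒tight
  where
  InΩ⇒tight : InΩ D → countB B * suc (suc d) ≡ 2 * n
  InΩ⇒tight Ω with InΩ⇒tight-packing D d minInDeg Ω
  ... | S , S-packing , S-tight =
    ≤-antisym (packing-bound D (suc d) B δ≤inDeg B-packing)
              (≤-trans (≤-reflexive (sym S-tight)) (*-monoˡ-≤ (suc (suc d)) (maximum S S-packing)))
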